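{- Let $G$ be a finite Hamiltonian group. Then $G$ is a DGI-group if and only if $G$ is a DCI-group, and $G$ is a GI-group if and only if $G$ is a CI-group.
   Context: A group is Hamiltonian if every subgroup is normal. All graphs are finite digraphs without loops or multiple arcs; undirected means the arc relation is symmetric. For a finite group $G$, a core-free subgroup $H$ (containing no nontrivial normal subgroup of $G$) and $S\subseteq G\setminus H$, the coset graph $\mathrm{Cos}(G,H,HSH)$ has vertex set the right cosets of $H$ in $G$, with an arc $Hx\to Hy$ iff $yx^{ -1}\in HSH$; every graph on which $G$ acts faithfully and vertex-transitively arises this way (a $G$-vertex-transitive graph). $\mathrm{Cos}(G,H,HSH)$ is a GI-graph of $G$ if for every $T\subseteq G\setminus H$ with $\mathrm{Cos}(G,H,HTH)\cong\mathrm{Cos}(G,H,HSH)$ there is $\tau\in\mathrm{Aut}(G)$ with $H^\tau=H$ and $HS^\tau H=HTH$. $G$ is a DGI-group if every coset graph of $G$ (every $G$-vertex-transitive graph) is a GI-graph of $G$, and a GI-group if every undirected one is. A Cayley graph of $G$ is $\mathrm{Cos}(G,1,S)$; a CI-graph of $G$ is a Cayley graph of $G$ that is a GI-graph of $G$; $G$ is a DCI-group if every Cayley graph of $G$ is a CI-graph, and a CI-group if every undirected Cayley graph of $G$ is a CI-graph. -}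

module Defs where

open import Data.Nat using (ℕ)
open import Data.Fin using (Fin)
open import Data.Fin.Subset using (Subset; _∈_; _∉_; ⁅_⁆)
open import Data.Product using (Σ; ∃; _×_; _,_)
open import Relation.Binary.PropositionalEquality using (_≡_)
open import Function.Bundles using (_⇔_)

-- A finite group, presented on the carrier Fin n (every finite group is
-- isomorphic to one of these) with propositional-equality laws.
record FinGroup : Set where
  infixl 7 _·_
  field
    n     : ℕ
    _·_   : Fin n → Fin n → Fin n
    e     : Fin n
    inv   : Fin n → Fin n
    assoc : ∀ x y z → (x · y) · z ≡ x · (y · z)
    idˡ   : ∀ x → e · x ≡ x
    idʳ   : ∀ x → x · e ≡ x
    invˡ  : ∀ x → inv x · x ≡ e
    invʳ  : ∀ x → x · inv x ≡ e

module _ (G : FinGroup) where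
  open FinGroup G

  El : Set
  El = Fin n

  IsSubgroup : Subset n → Set
  IsSubgroup H = (e ∈ H)
               × (∀ x y → x ∈ H → y ∈ H → x · y ∈ H)
               × (∀ x → x ∈ H → inv x ∈ H)

  IsNormal : Subset n → Set
  IsNormal N = IsSubgroup N × (∀ g x → x ∈ N → (inv g · x) · g ∈ N)

  CoreFree : Subset n → Set
  CoreFree H = ∀ N → IsNormal N → (∀ x → x ∈ N → x ∈ H) → ∀ x → x ∈ N → x ≡ e

  Hamiltonian : Set
  Hamiltonian = ∀ H → IsSubgroup H → IsNormal H

  Avoids : Subset n → Subset n → Set
  Avoids H S = ∀ x → x ∈ S → x ∉ H

  InHPH : Subset n → (El → Set) → El → Set
  InHPH H P g = Σ El λ h₁ → Σ El λ x → Σ El λ h₂ →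
                  (h₁ ∈ H) × P x × (h₂ ∈ H) × (g ≡ (h₁ · x) · h₂)

  InHSH : Subset n → Subset n → El → Set
  InHSH H S = InHPH H (λ x → x ∈ S)

  -- right cosets: H x = H y  iff  x y⁻¹ ∈ H
  SameCoset : Subset n → El → El → Set
  SameCoset H x y = x · inv y ∈ H

  -- arc H x → H y in Cos(G,H,HSH), stated on coset representatives
  -- (well defined on cosets since HSH is a union of (H,H)-double cosets)
  Arc : Subset n → Subset n → El → El → Set
  Arc H S x y = InHSH H S (y · inv x)

  Undirected : Subset n → Subset n → Set
  Undirected H S = ∀ x y → Arc H S x y → Arc H S y x

  -- a digraph isomorphism Cos(G,H,HSH) ≅ Cos(G,H,HTH): a map on
  -- representatives inducing a well-defined bijection of the right cosets
  -- of H which preserves and reflects arcs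
  CosIso : Subset n → Subset n → Subset n → Set
  CosIso H S T = Σ (El → El) λ φ →
      (∀ x y → SameCoset H x y → SameCoset H (φ x) (φ y))
    × (∀ x y → SameCoset H (φ x) (φ y) → SameCoset H x y)
    × (∀ y → Σ El λ x → SameCoset H (φ x) y)
    × (∀ x y → Arc H S x y ⇔ Arc H T (φ x) (φ y))

  record Aut : Set where
    field
      τ      : El → El
      τ⁻¹    : El → El
      hom    : ∀ x y → τ (x · y) ≡ τ x · τ y
      invl   : ∀ x → τ⁻¹ (τ x) ≡ x
      invr   : ∀ y → τ (τ⁻¹ y) ≡ y

  IsGIGraph : Subset n → Subset n → Set
  IsGIGraph H S = ∀ T → Avoids H T → CosIso H S T →
    Σ Aut λ σ → let open Aut σ in
        (∀ x → (x ∈ H) ⇔ (τ x ∈ H))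
      × (∀ g → InHPH H (λ y → Σ El λ s → (s ∈ S) × (τ s ≡ y)) g
                 ⇔ InHSH H T g)                                    -- H S^τ H = H T H

  IsDGIGroup : Set
  IsDGIGroup = ∀ H S → IsSubgroup H → CoreFree H → Avoids H S → IsGIGraph H S

  IsGIGroup : Set
  IsGIGroup = ∀ H S → IsSubgroup H → CoreFree H → Avoids H S →
              Undirected H S → IsGIGraph H S

  -- Cayley graphs: H = 1
  One : Subset n
  One = ⁅ e ⁆

  IsDCIGroup : Set
  IsDCIGroup = ∀ S → Avoids One S → IsGIGraph One S

  IsCIGroup : Set
  IsCIGroup = ∀ S → Avoids One S → Undirected One S → IsGIGraph One S

-- A Hamiltonian group has no nontrivial core-free subgroups: every subgroup
-- is normal, so it lies in its own core.  Hence the only coset graphs of G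
-- are Cayley graphs, and the GI (resp. DGI) property quantifies over exactly
-- the same graphs as the CI (resp. DCI) property.
module Submission where

open import Defs
open import Data.Product using (_×_; _,_; proj₁)
open import Function.Bundles using (_⇔_; mk⇔)
open import Data.Fin.Subset using (Subset; _∈_)
open import Data.Fin.Subset.Properties using (x∈⁅x⁆; x∈⁅y⁆⇒x≡y; ⊆-antisym)
open import Relation.Binary.PropositionalEquality using (_≡_; refl; sym; trans; cong; cong₂; subst)

module _ (G : FinGroup) where
  open FinGroup G

  inv-e : inv e ≡ e
  inv-e = trans (sym (idʳ (inv e))) (invˡ e)

  ≡e⇒∈One : ∀ {x} → x ≡ e → x ∈ One G
  ≡e⇒∈One refl = x∈⁅x⁆ e

  ∈One⇒≡e : ∀ {x} → x ∈ One G → x ≡ e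
  ∈One⇒≡e = x∈⁅y⁆⇒x≡y e

  One-isSubgroup : IsSubgroup G (One G)
  One-isSubgroup = x∈⁅x⁆ e , ·-closed , inv-closed
    where
    ·-closed : ∀ x y → x ∈ One G → y ∈ One G → x · y ∈ One G
    ·-closed x y x∈ y∈ = ≡e⇒∈One (trans (cong₂ _·_ (∈One⇒≡e x∈) (∈One⇒≡e y∈)) (idˡ e))

    inv-closed : ∀ x → x ∈ One G → inv x ∈ One G
    inv-closed x x∈ = ≡e⇒∈One (trans (cong inv (∈One⇒≡e x∈)) inv-e)

  One-coreFree : CoreFree G (One G)
  One-coreFree N _ N⊆One x x∈N = ∈One⇒≡e (N⊆One x x∈N)

  coreFree∧normal⇒≡One : ∀ H → IsNormal G H → CoreFree G H → H ≡ One G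
  coreFree∧normal⇒≡One H normal coreFree = ⊆-antisym
    (λ {x} x∈H → ≡e⇒∈One (coreFree H normal (λ _ y∈H → y∈H) x x∈H))
    (λ {x} x∈One → subst (_∈ H) (sym (∈One⇒≡e x∈One)) (proj₁ (proj₁ normal)))

  hamiltonian⇒coreFree⇒≡One : Hamiltonian G →
                               ∀ H → IsSubgroup G H → CoreFree G H → H ≡ One G
  hamiltonian⇒coreFree⇒≡One ham H subgroup =
    coreFree∧normal⇒≡One H (ham H subgroup)

  module _ (onlyOne : ∀ H → IsSubgroup G H → CoreFree G H → H ≡ One G) where

    DGI⇔DCI : IsDGIGroup G ⇔ IsDCIGroup G
    DGI⇔DCI = mk⇔
      (λ dgi S → dgi (One G) S One-isSubgroup One-coreFree)
      (λ dci H S subgroup coreFree → fromOne (onlyOne H subgroup coreFree) dci)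
      where
      fromOne : ∀ {H S} → H ≡ One G → IsDCIGroup G → Avoids G H S → IsGIGraph G H S
      fromOne refl dci = dci _

    GI⇔CI : IsGIGroup G ⇔ IsCIGroup G
    GI⇔CI = mk⇔
      (λ gi S → gi (One G) S One-isSubgroup One-coreFree)
      (λ ci H S subgroup coreFree → fromOne (onlyOne H subgroup coreFree) ci)
      where
      fromOne : ∀ {H S} → H ≡ One G → IsCIGroup G →
                Avoids G H S → Undirected G H S → IsGIGraph G H S
      fromOne refl ci = ci _

mainTheorem3 : (G : FinGroup) → Hamiltonian G →
               (IsDGIGroup G ⇔ IsDCIGroup G) × (IsGIGroup G ⇔ IsCIGroup G)
mainTheorem3 G ham = DGI⇔DCI G onlyOne , GI⇔CI G onlyOne
  where
  onlyOne : ∀ H → IsSubgroup G H → CoreFree G H → H ≡ One G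
  onlyOne = hamiltonian⇒coreFree⇒≡One G ham
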